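{- For all $k\in\mathbb{N}$ and all $t\in\{\triangle(1,0,0),\triangle(0,1,0),\triangle(0,0,1),\triangledown(1,0,0),\triangledown(0,1,0),\triangledown(0,0,1)\}$, the values at three vertices of $\sigma^k(t)$ forming an equilateral triangle with the same center as $\sigma^k(t)$ cannot all equal $0$.
   Context: Let $p$ be an odd prime and $\mathbb{F}_p$ the field with $p$ elements. A tile is a unit equilateral triangle of the standard triangular lattice, oriented upward or downward, whose corners are decorated with elements of $\mathbb{F}_p$. $\triangle(x,y,z)$ is the upward tile with bottom-left, bottom-right, top corners $x,y,z$; $\triangledown(x,y,z)$ the downward tile with top-right, top-left, bottom corners $x,y,z$. The substitution $\sigma$ inflates a tile by factor $2$ and replaces it by four unit tiles: $\sigma(\triangle(x,y,z))$ consists of bottom-left $\triangle(x,x+y,x+z)$, bottom-right $\triangle(x+y,y,y+z)$, top $\triangle(x+z,y+z,z)$ and central $\triangledown(y+z,x+z,x+y)$; $\sigma(\triangledown(x,y,z))$ consists of top-right $\triangledown(x,x+y,x+z)$, top-left $\triangledown(x+y,y,y+z)$, bottom $\triangledown(x+z,y+z,z)$ and central $\triangle(y+z,x+z,x+y)$. $\sigma$ acts on patches tile by tile; $\sigma^k(t)$ is a triangle of side $2^k$ made of $4^k$ decorated unit tiles, and corners of tiles meeting at the same lattice vertex carry the same value, so each lattice vertex of $\sigma^k(t)$ has a well-defined value. -}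

module Defs where

open import Data.Nat using (ℕ; zero; suc; _+_; _*_; _∸_; _^_; _≤_; _≤ᵇ_)
open import Data.Bool using (if_then_else_)
open import Data.Product using (_×_; _,_)
open import Data.List using (List; _∷_; [])
open import Data.Integer as ℤ using (ℤ; +_)
open import Relation.Binary.PropositionalEquality using (_≡_; _≢_)

-- Values are natural-number representatives of elements of F_p.
-- Only additions occur in the substitution, so reducing mod p at the end
-- (i.e. testing "p ∣ v" for "v = 0 in F_p") is faithful.

data Orient : Set where
  up down : Orient

-- up   x y z : △(x,y,z)  bottom-left, bottom-right, top
-- down x y z : ▽(x,y,z)  top-right,   top-left,     bottom
record Tile : Set where
  constructor tile
  field
    orient : Orient
    x y z  : ℕ

flip : Orient → Orient
flip up   = down
flip down = up

-- Local vertex coordinates of a (super)tile of side n: (i , j) with i + j ≤ n.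
-- For an upward tile the vertex (i , j) is at  BL + i·e₁ + j·e₂
--   (e₁ = unit vector to the right, e₂ = unit vector at 60°),
--   so BL = (0,0), BR = (n,0), Top = (0,n).
-- For a downward tile the frame is point-reflected: vertex (i , j) is at
--   TR − i·e₁ − j·e₂, so TR = (0,0), TL = (n,0), Bottom = (0,n).
-- With these frames the substitution rules for △ and ▽ read identically.

Vertex : Set
Vertex = ℕ × ℕ

-- The value at local vertex (i , j) of σ^k(t)  (side 2^k).
-- σ^(k+1)(t) = σ^k(σ(t)): the four tiles of σ(t) become supertiles of side 2^k.
-- (Vertices on shared boundaries carry equal values, so choosing a subtile
-- in a fixed priority order is harmless.)  Out-of-range vertices get 0.
val : ℕ → Tile → Vertex → ℕ
val zero (tile o x y z) (0 , 0) = x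
val zero (tile o x y z) (1 , 0) = y
val zero (tile o x y z) (0 , 1) = z
val zero (tile o x y z) _       = 0
val (suc k) (tile o x y z) (i , j) =
  if i + j ≤ᵇ h then val k (tile o x (x + y) (x + z)) (i , j)             -- bottom-left / top-right
  else if h ≤ᵇ i then val k (tile o (x + y) y (y + z)) (i ∸ h , j)       -- bottom-right / top-left
  else if h ≤ᵇ j then val k (tile o (x + z) (y + z) z) (i , j ∸ h)       -- top / bottom
  else val k (tile (flip o) (y + z) (x + z) (x + y)) (h ∸ i , h ∸ j)
  where
    h : ℕ
    h = 2 ^ k

InTri : ℕ → Vertex → Set
InTri n (i , j) = i + j ≤ n

-- squared Euclidean distance between lattice points i·e₁ + j·e₂
sqDist : Vertex → Vertex → ℤ
sqDist (i₁ , j₁) (i₂ , j₂) = di ℤ.* di ℤ.+ di ℤ.* dj ℤ.+ dj ℤ.* dj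
  where
    di = + i₁ ℤ.- + i₂
    dj = + j₁ ℤ.- + j₂

Equilateral : Vertex → Vertex → Vertex → Set
Equilateral v₁ v₂ v₃ =
  v₁ ≢ v₂ × sqDist v₁ v₂ ≡ sqDist v₂ v₃ × sqDist v₂ v₃ ≡ sqDist v₃ v₁

-- the centroid of v₁ v₂ v₃ equals the centroid of the triangle of side n,
-- which in local coordinates is (n/3 , n/3) (corners (0,0),(n,0),(0,n))
SameCenter : ℕ → Vertex → Vertex → Vertex → Set
SameCenter n (i₁ , j₁) (i₂ , j₂) (i₃ , j₃) =
  i₁ + i₂ + i₃ ≡ n × j₁ + j₂ + j₃ ≡ n

initialTiles : List Tile
initialTiles =
  tile up 1 0 0 ∷ tile up 0 1 0 ∷ tile up 0 0 1 ∷
  tile down 1 0 0 ∷ tile down 0 1 0 ∷ tile down 0 0 1 ∷ []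

-- The value of σ^k(t) at a vertex is additive in the labels of t, so it is a linear form whose
-- coefficients are the values of the three unit tiles.  One substitution step acts on this
-- coefficient vector by a matrix of determinant 1 (corner quarters) or 2 (central quarter), so
-- modulo an odd prime the vector never vanishes.  Rotating the labels of a tile rotates σ^k(t):
-- the recursion hands a vertex on a shared edge to one fixed quarter, but neighbouring quarters
-- agree there, because the values along an edge depend only on the values at its two ends.
-- Hence the values of a unit tile at the rotation orbit (i , j), (j , l), (l , i) about the
-- centre are, up to a cyclic shift, the coefficients at (i , j).  Finally, an equilateral
-- triangle centred at the centroid is such an orbit: 18 N(P) N(P′) is the sum of the squared
-- differences of its squared side lengths, where N is the (positive definite) squared norm and
-- P = 0, P′ = 0 say that the second vertex is the image of the first under one of the two rotations.
module Submission where

open import Defs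
open import Data.Nat using (ℕ; _%_; _^_)
open import Data.Nat.Divisibility using (_∣_)
open import Data.Nat.Primality using (Prime)
open import Data.Product using (_×_; _,_)
open import Data.Sum using (_⊎_; inj₁; inj₂)
open import Data.List.Membership.Propositional using (_∈_)
open import Relation.Binary.PropositionalEquality
open import Relation.Nullary using (¬_)

module Plane where
  import Data.Nat as ℕ
  import Data.Nat.Properties as ℕ
  open import Data.Integer using (ℤ; +_; -[1+_]; 0ℤ; ∣_∣; _+_; _-_; _*_)
  open import Data.Integer.Properties
    using (pos-+; pos-*; ∣i∣≡0⇒i≡0; i*j≡0⇒i≡0∨j≡0; i-j≡0⇒i≡j; i≡j⇒i-j≡0; +-injective; +-identityʳ)
  open import Data.Integer.Solver using (module +-*-Solver)
  open +-*-Solver using (solve; _:=_; _:+_; _:-_; _:*_; con; Polynomial)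
  open ≡-Reasoning

  norm : ℤ → ℤ → ℤ
  norm i j = i * i + i * j + j * j

  normₚ : ∀ {m} → Polynomial m → Polynomial m → Polynomial m
  normₚ i j = i :* i :+ i :* j :+ j :* j

  square≡abs² : ∀ i → i * i ≡ + (∣ i ∣ ℕ.* ∣ i ∣)
  square≡abs² (+ n)    = sym (pos-* n n)
  square≡abs² -[1+ n ] = refl

  abs²≡0⇒≡0 : ∀ i → ∣ i ∣ ℕ.* ∣ i ∣ ≡ 0 → i ≡ 0ℤ
  abs²≡0⇒≡0 i ∣i∣²≡0 with ℕ.m*n≡0⇒m≡0∨n≡0 ∣ i ∣ ∣i∣²≡0
  ... | inj₁ ∣i∣≡0 = ∣i∣≡0⇒i≡0 ∣i∣≡0
  ... | inj₂ ∣i∣≡0 = ∣i∣≡0⇒i≡0 ∣i∣≡0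

  norm≡0⇒≡0 : ∀ i j → norm i j ≡ 0ℤ → i ≡ 0ℤ × j ≡ 0ℤ
  norm≡0⇒≡0 i j norm≡0 = i≡0 , j≡0
    where
    completed : ∀ i j → + 4 * norm i j ≡ (+ 2 * i + j) * (+ 2 * i + j) + + 3 * (j * j)
    completed = solve 2 (λ i j →
      con (+ 4) :* normₚ i j := (con (+ 2) :* i :+ j) :* (con (+ 2) :* i :+ j) :+ con (+ 3) :* (j :* j)) refl
    s = + 2 * i + j
    s² = ∣ s ∣ ℕ.* ∣ s ∣
    j² = ∣ j ∣ ℕ.* ∣ j ∣
    s²+3j²≡0 : s² ℕ.+ 3 ℕ.* j² ≡ 0
    s²+3j²≡0 = +-injective (begin
      + (s² ℕ.+ 3 ℕ.* j²)    ≡⟨ pos-+ s² (3 ℕ.* j²) ⟩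
      + s² + + (3 ℕ.* j²)    ≡⟨ cong₂ _+_ (square≡abs² s) (trans (cong (+ 3 *_) (square≡abs² j)) (sym (pos-* 3 j²))) ⟨
      s * s + + 3 * (j * j)  ≡⟨ completed i j ⟨
      + 4 * norm i j         ≡⟨ cong (+ 4 *_) norm≡0 ⟩
      0ℤ                     ∎)
    j≡0 : j ≡ 0ℤ
    j≡0 = abs²≡0⇒≡0 j (ℕ.m*n≡0⇒m≡0 j² 3 (trans (ℕ.*-comm j² 3) (ℕ.m+n≡0⇒n≡0 s² s²+3j²≡0)))
    2i≡0 : + 2 * i ≡ 0ℤ
    2i≡0 = begin
      + 2 * i       ≡⟨ +-identityʳ (+ 2 * i) ⟨
      + 2 * i + 0ℤ  ≡⟨ cong (λ j → + 2 * i + j) j≡0 ⟨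
      s             ≡⟨ abs²≡0⇒≡0 s (ℕ.m+n≡0⇒m≡0 s² s²+3j²≡0) ⟩
      0ℤ            ∎
    i≡0 : i ≡ 0ℤ
    i≡0 with i*j≡0⇒i≡0∨j≡0 (+ 2) 2i≡0
    ... | inj₂ i≡0 = i≡0

  sq : ℤ → ℤ
  sq i = i * i

  -- For a triangle with centroid (n/3 , n/3), the two norms on the left vanish exactly when
  -- (i₂ , j₂) is the image of (i₁ , j₁) under one of the two rotations by a third of a turn.
  side-differences : ∀ i₁ j₁ i₂ j₂ n →
    + 18 * (norm (i₁ + j₁ + i₂ - n) (j₂ - i₁) * norm (i₂ - j₁) (i₁ + j₁ + j₂ - n)) ≡
    sq (norm (i₁ - i₂) (j₁ - j₂) - norm (i₂ - (n - i₁ - i₂)) (j₂ - (n - j₁ - j₂))) +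
    sq (norm (i₂ - (n - i₁ - i₂)) (j₂ - (n - j₁ - j₂)) - norm (n - i₁ - i₂ - i₁) (n - j₁ - j₂ - j₁)) +
    sq (norm (n - i₁ - i₂ - i₁) (n - j₁ - j₂ - j₁) - norm (i₁ - i₂) (j₁ - j₂))
  side-differences = solve 5 (λ i₁ j₁ i₂ j₂ n →
    con (+ 18) :* (normₚ (i₁ :+ j₁ :+ i₂ :- n) (j₂ :- i₁) :* normₚ (i₂ :- j₁) (i₁ :+ j₁ :+ j₂ :- n)) :=
    sqₚ (normₚ (i₁ :- i₂) (j₁ :- j₂) :- normₚ (i₂ :- (n :- i₁ :- i₂)) (j₂ :- (n :- j₁ :- j₂))) :+
    sqₚ (normₚ (i₂ :- (n :- i₁ :- i₂)) (j₂ :- (n :- j₁ :- j₂)) :- normₚ (n :- i₁ :- i₂ :- i₁) (n :- j₁ :- j₂ :- j₁)) :+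
    sqₚ (normₚ (n :- i₁ :- i₂ :- i₁) (n :- j₁ :- j₂ :- j₁) :- normₚ (i₁ :- i₂) (j₁ :- j₂))) refl
    where
    sqₚ : ∀ {m} → Polynomial m → Polynomial m
    sqₚ i = i :* i

  equal⇒squared-differences≡0 : ∀ {a b c} → a ≡ b → b ≡ c → sq (a - b) + sq (b - c) + sq (c - a) ≡ 0ℤ
  equal⇒squared-differences≡0 a≡b b≡c =
    cong₂ _+_ (cong₂ _+_ (cong sq (i≡j⇒i-j≡0 a≡b)) (cong sq (i≡j⇒i-j≡0 b≡c)))
              (cong sq (i≡j⇒i-j≡0 (sym (trans a≡b b≡c))))

  equilateral⇒rotationℤ : ∀ i₁ j₁ i₂ j₂ i₃ j₃ n → i₃ ≡ n - i₁ - i₂ → j₃ ≡ n - j₁ - j₂ →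
    norm (i₁ - i₂) (j₁ - j₂) ≡ norm (i₂ - i₃) (j₂ - j₃) →
    norm (i₂ - i₃) (j₂ - j₃) ≡ norm (i₃ - i₁) (j₃ - j₁) →
    (i₁ + j₁ + i₂ ≡ n × j₂ ≡ i₁) ⊎ (i₂ ≡ j₁ × i₁ + j₁ + j₂ ≡ n)
  equilateral⇒rotationℤ i₁ j₁ i₂ j₂ _ _ n refl refl d₁₂≡d₂₃ d₂₃≡d₃₁ =
    rotations (i*j≡0⇒i≡0∨j≡0 (+ 18) (trans (side-differences i₁ j₁ i₂ j₂ n) (equal⇒squared-differences≡0 d₁₂≡d₂₃ d₂₃≡d₃₁)))
    where
    rotations : + 18 ≡ 0ℤ ⊎ norm (i₁ + j₁ + i₂ - n) (j₂ - i₁) * norm (i₂ - j₁) (i₁ + j₁ + j₂ - n) ≡ 0ℤ →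
                (i₁ + j₁ + i₂ ≡ n × j₂ ≡ i₁) ⊎ (i₂ ≡ j₁ × i₁ + j₁ + j₂ ≡ n)
    rotations (inj₂ NP*NP′≡0) with i*j≡0⇒i≡0∨j≡0 (norm (i₁ + j₁ + i₂ - n) (j₂ - i₁)) NP*NP′≡0
    ... | inj₁ NP≡0  = let P₁≡0 , P₂≡0 = norm≡0⇒≡0 _ _ NP≡0
                       in inj₁ (i-j≡0⇒i≡j _ _ P₁≡0 , i-j≡0⇒i≡j _ _ P₂≡0)
    ... | inj₂ NP′≡0 = let P₁≡0 , P₂≡0 = norm≡0⇒≡0 _ _ NP′≡0
                       in inj₂ (i-j≡0⇒i≡j _ _ P₁≡0 , i-j≡0⇒i≡j _ _ P₂≡0)

  pos-+₃ : ∀ a b c → + (a ℕ.+ b ℕ.+ c) ≡ + a + + b + + c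
  pos-+₃ a b c = trans (pos-+ (a ℕ.+ b) c) (cong (_+ + c) (pos-+ a b))

  pos-remainder : ∀ {a b c n} → a ℕ.+ b ℕ.+ c ≡ n → + c ≡ + n - + a - + b
  pos-remainder {a} {b} {c} refl = trans (cancel (+ a) (+ b) (+ c)) (cong (λ m → m - + a - + b) (sym (pos-+₃ a b c)))
    where
    cancel : ∀ a b c → c ≡ a + b + c - a - b
    cancel = solve 3 (λ a b c → c := a :+ b :+ c :- a :- b) refl

  equilateral⇒rotation : ∀ {n i₁ j₁ i₂ j₂ i₃ j₃} → SameCenter n (i₁ , j₁) (i₂ , j₂) (i₃ , j₃) →
    sqDist (i₁ , j₁) (i₂ , j₂) ≡ sqDist (i₂ , j₂) (i₃ , j₃) →
    sqDist (i₂ , j₂) (i₃ , j₃) ≡ sqDist (i₃ , j₃) (i₁ , j₁) →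
    (i₁ ℕ.+ j₁ ℕ.+ i₂ ≡ n × j₂ ≡ i₁) ⊎ (i₂ ≡ j₁ × i₁ ℕ.+ j₁ ℕ.+ j₂ ≡ n)
  equilateral⇒rotation {n} {i₁} {j₁} {i₂} {j₂} {i₃} {j₃} (Σi≡n , Σj≡n) d₁₂≡d₂₃ d₂₃≡d₃₁
    with equilateral⇒rotationℤ (+ i₁) (+ j₁) (+ i₂) (+ j₂) (+ i₃) (+ j₃) (+ n)
           (pos-remainder {i₁} {i₂} Σi≡n) (pos-remainder {j₁} {j₂} Σj≡n) d₁₂≡d₂₃ d₂₃≡d₃₁
  ... | inj₁ (Σ≡n , j₂≡i₁) = inj₁ (+-injective (trans (pos-+₃ i₁ j₁ i₂) Σ≡n) , +-injective j₂≡i₁)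
  ... | inj₂ (i₂≡j₁ , Σ≡n) = inj₂ (+-injective i₂≡j₁ , +-injective (trans (pos-+₃ i₁ j₁ j₂) Σ≡n))

open Plane using (equilateral⇒rotation)
open import Data.Nat using (nonTrivial⇒≢1; zero; suc; _+_; _*_; _∸_; _≤_; _<_; _≰_; _≤ᵇ_; z≤n; s≤s)
open import Data.Nat.Properties
open import Data.Nat.Divisibility using (∣1⇒≡1; ∣⇒≤; ∣m∣n⇒∣m+n; ∣m+n∣m⇒∣n)
open import Data.Nat.Primality using (prime⇒nonTrivial; euclidsLemma)
open import Data.Nat.Tactic.RingSolver using (solve-∀)
open import Data.Bool using (true; false; if_then_else_)
open import Data.Product using (proj₁)
open import Data.Empty using (⊥; ⊥-elim)
open import Data.List.Relation.Unary.Any using (here; there)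
open import Function using (_∘_)
open import Relation.Nullary using (yes; no; contradiction)
open import Relation.Nullary.Reflects using (ofʸ; ofⁿ)
open import Algebra.Properties.CommutativeSemigroup +-commutativeSemigroup
  using (interchange; x∙yz≈y∙xz; xy∙z≈y∙xz; xy∙z≈yz∙x; xy∙z≈xz∙y)
open ≡-Reasoning

≤ᵇ-true : ∀ {m n} → m ≤ n → (m ≤ᵇ n) ≡ true
≤ᵇ-true {m} {n} m≤n with m ≤ᵇ n | ≤ᵇ-reflects-≤ m n
... | true  | _       = refl
... | false | ofⁿ m≰n = contradiction m≤n m≰n

≤ᵇ-false : ∀ {m n} → m ≰ n → (m ≤ᵇ n) ≡ false
≤ᵇ-false {m} {n} m≰n with m ≤ᵇ n | ≤ᵇ-reflects-≤ m n
... | false | _       = refl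
... | true  | ofʸ m≤n = contradiction m≤n m≰n

2^suc : ∀ k → 2 ^ suc k ≡ 2 ^ k + 2 ^ k
2^suc k = cong (2 ^ k +_) (+-identityʳ (2 ^ k))

sum≡double-≤ : ∀ {m m′ h} → m + m′ ≡ h + h → m ≤ h → m′ ≤ h → m ≡ h
sum≡double-≤ {m} {m′} {h} eq m≤h m′≤h =
  ≤-antisym m≤h (+-cancelʳ-≤ h h m (≤-trans (≤-reflexive (sym eq)) (+-monoʳ-≤ m m′≤h)))

sum≡double-≰ : ∀ {m m′ h} → m + m′ ≡ h + h → m ≰ h → m′ ≰ h → ⊥
sum≡double-≰ eq m≰h m′≰h = <⇒≱ (+-mono-< (≰⇒> m≰h) (≰⇒> m′≰h)) (≤-reflexive eq)

sum≡double-∸ : ∀ {m m′ h} → m + m′ ≡ h + h → h ≤ m′ → m + (m′ ∸ h) ≡ h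
sum≡double-∸ {m} {m′} {h} eq h≤m′ = +-cancelʳ-≡ _ _ h (begin
  m + (m′ ∸ h) + h ≡⟨ +-assoc m (m′ ∸ h) h ⟩
  m + (m′ ∸ h + h) ≡⟨ cong (m +_) (m∸n+n≡m h≤m′) ⟩
  m + m′           ≡⟨ eq ⟩
  h + h            ∎)

≡+suc⇒≰ : ∀ {m n} d → m ≡ n + suc d → m ≰ n
≡+suc⇒≰ {n = n} d m≡n+1+d m≤n = m+1+n≰m n (subst (_≤ n) m≡n+1+d m≤n)

summand≥sum : ∀ {m n h} → m + n ≡ h → h ≤ m → m ≡ h × n ≡ 0
summand≥sum {m} {n} m+n≡h h≤m = m≡h , +-cancelˡ-≡ m n 0 (trans m+n≡h (trans (sym m≡h) (sym (+-identityʳ m))))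
  where
  m≡h : m ≡ _
  m≡h = ≤-antisym (subst (m ≤_) m+n≡h (m≤m+n m n)) h≤m

rotate-sum : ∀ i j l {h} → i + j + l ≡ h → j + l + i ≡ h
rotate-sum i j l = trans (sym (xy∙z≈yz∙x i j l))

+-cancel-last : ∀ a b {c d n} → a + b + c ≡ n → a + b + d ≡ n → c ≡ d
+-cancel-last a b {c} {d} a+b+c≡n a+b+d≡n = +-cancelˡ-≡ (a + b) c d (trans a+b+c≡n (sym a+b+d≡n))

vertex-cong : ∀ k t {i i′ j j′} → i ≡ i′ → j ≡ j′ → val k t (i , j) ≡ val k t (i′ , j′)
vertex-cong k t = cong₂ (λ i j → val k t (i , j))

corners-cong : ∀ {o x x′ y y′ z z′} → x ≡ x′ → y ≡ y′ → z ≡ z′ → tile o x y z ≡ tile o x′ y′ z′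
corners-cong refl refl refl = refl

val-suc₁ : ∀ k o x y z {h i j} → 2 ^ k ≡ h → i + j ≤ h →
  val (suc k) (tile o x y z) (i , j) ≡ val k (tile o x (x + y) (x + z)) (i , j)
val-suc₁ k o x y z refl i+j≤h rewrite ≤ᵇ-true i+j≤h = refl

val-suc₂ : ∀ k o x y z {h i j} → 2 ^ k ≡ h → i + j ≰ h → h ≤ i →
  val (suc k) (tile o x y z) (i , j) ≡ val k (tile o (x + y) y (y + z)) (i ∸ h , j)
val-suc₂ k o x y z refl i+j≰h h≤i rewrite ≤ᵇ-false i+j≰h | ≤ᵇ-true h≤i = refl

val-suc₃ : ∀ k o x y z {h i j} → 2 ^ k ≡ h → i + j ≰ h → h ≰ i → h ≤ j →
  val (suc k) (tile o x y z) (i , j) ≡ val k (tile o (x + z) (y + z) z) (i , j ∸ h)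
val-suc₃ k o x y z refl i+j≰h h≰i h≤j rewrite ≤ᵇ-false i+j≰h | ≤ᵇ-false h≰i | ≤ᵇ-true h≤j = refl

val-suc₄ : ∀ k o x y z {h i j} → 2 ^ k ≡ h → i + j ≰ h → h ≰ i → h ≰ j →
  val (suc k) (tile o x y z) (i , j) ≡ val k (tile (flip o) (y + z) (x + z) (x + y)) (h ∸ i , h ∸ j)
val-suc₄ k o x y z refl i+j≰h h≰i h≰j rewrite ≤ᵇ-false i+j≰h | ≤ᵇ-false h≰i | ≤ᵇ-false h≰j = refl

val-additive : ∀ k o x y z x′ y′ z′ v →
  val k (tile o (x + x′) (y + y′) (z + z′)) v ≡ val k (tile o x y z) v + val k (tile o x′ y′ z′) v
val-additive zero o x y z x′ y′ z′ (zero , zero)        = refl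
val-additive zero o x y z x′ y′ z′ (suc zero , zero)    = refl
val-additive zero o x y z x′ y′ z′ (zero , suc zero)    = refl
val-additive zero o x y z x′ y′ z′ (zero , suc (suc _)) = refl
val-additive zero o x y z x′ y′ z′ (suc zero , suc _)   = refl
val-additive zero o x y z x′ y′ z′ (suc (suc _) , _)    = refl
val-additive (suc k) o x y z x′ y′ z′ (i , j) with i + j ≤ᵇ 2 ^ k | 2 ^ k ≤ᵇ i | 2 ^ k ≤ᵇ j
... | true  | _     | _     = trans
  (cong (λ t → val k t (i , j)) (corners-cong refl (interchange x x′ y y′) (interchange x x′ z z′)))
  (val-additive k o x (x + y) (x + z) x′ (x′ + y′) (x′ + z′) (i , j))
... | false | true  | _     = trans
  (cong (λ t → val k t (i ∸ 2 ^ k , j)) (corners-cong (interchange x x′ y y′) refl (interchange y y′ z z′)))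
  (val-additive k o (x + y) y (y + z) (x′ + y′) y′ (y′ + z′) (i ∸ 2 ^ k , j))
... | false | false | true  = trans
  (cong (λ t → val k t (i , j ∸ 2 ^ k)) (corners-cong (interchange x x′ z z′) (interchange y y′ z z′) refl))
  (val-additive k o (x + z) (y + z) z (x′ + z′) (y′ + z′) z′ (i , j ∸ 2 ^ k))
... | false | false | false = trans
  (cong (λ t → val k t (2 ^ k ∸ i , 2 ^ k ∸ j))
        (corners-cong (interchange y y′ z z′) (interchange x x′ z z′) (interchange x x′ y y′)))
  (val-additive k (flip o) (y + z) (x + z) (x + y) (y′ + z′) (x′ + z′) (x′ + y′) (2 ^ k ∸ i , 2 ^ k ∸ j))

val-111 : ∀ k o v →
  val k (tile o 1 1 1) v ≡ val k (tile o 1 0 0) v + (val k (tile o 0 1 0) v + val k (tile o 0 0 1) v)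
val-111 k o v =
  trans (val-additive k o 1 0 0 0 1 1 v) (cong (val k (tile o 1 0 0) v +_) (val-additive k o 0 1 0 0 0 1 v))

-- The values along the bottom edge of σ^k(tile o a b _), from left to right
-- (only arguments m ≤ 2 ^ k are meaningful).
edge : ℕ → ℕ → ℕ → ℕ → ℕ
edge zero    a b zero    = a
edge zero    a b (suc _) = b
edge (suc k) a b m =
  if m ≤ᵇ 2 ^ k then edge k a (a + b) m else edge k (a + b) b (m ∸ 2 ^ k)

edge-suc₁ : ∀ k a b {m} → m ≤ 2 ^ k → edge (suc k) a b m ≡ edge k a (a + b) m
edge-suc₁ k a b m≤h rewrite ≤ᵇ-true m≤h = refl

edge-suc₂ : ∀ k a b {m} → m ≰ 2 ^ k → edge (suc k) a b m ≡ edge k (a + b) b (m ∸ 2 ^ k)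
edge-suc₂ k a b m≰h rewrite ≤ᵇ-false m≰h = refl

edge-start : ∀ k {a b} → edge k a b 0 ≡ a
edge-start zero            = refl
edge-start (suc k) {a} {b} = trans (edge-suc₁ k a b z≤n) (edge-start k)

edge-end : ∀ k {a b} → edge k a b (2 ^ k) ≡ b
edge-end zero            = refl
edge-end (suc k) {a} {b} = begin
  edge (suc k) a b (2 ^ suc k)          ≡⟨ edge-suc₂ k a b 2h≰h ⟩
  edge k (a + b) b (2 ^ suc k ∸ 2 ^ k)  ≡⟨ cong (edge k (a + b) b) 2h∸h≡h ⟩
  edge k (a + b) b (2 ^ k)              ≡⟨ edge-end k ⟩
  b                                     ∎
  where
  2h∸h≡h : 2 ^ suc k ∸ 2 ^ k ≡ 2 ^ k
  2h∸h≡h = trans (cong (_∸ 2 ^ k) (2^suc k)) (m+n∸m≡n (2 ^ k) (2 ^ k))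
  2h≰h : 2 ^ suc k ≰ 2 ^ k
  2h≰h = <⇒≱ (subst (2 ^ k <_) (sym (2^suc k)) (m<m+n (2 ^ k) (m^n>0 2 k)))

edge-reverse : ∀ k {m m′ a b} → m + m′ ≡ 2 ^ k → edge k a b m ≡ edge k b a m′
edge-reverse zero    {zero}              refl = refl
edge-reverse zero    {suc zero} {zero}   refl = refl
edge-reverse zero    {suc zero} {suc _}  ()
edge-reverse zero    {suc (suc _)}       ()
edge-reverse (suc k) {m} {m′} {a} {b} eq with m ≤? 2 ^ k | m′ ≤? 2 ^ k
... | yes m≤h | yes m′≤h = begin
  edge (suc k) a b m       ≡⟨ edge-suc₁ k a b m≤h ⟩
  edge k a (a + b) m       ≡⟨ cong (edge k a (a + b)) (sum≡double-≤ eq′ m≤h m′≤h) ⟩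
  edge k a (a + b) (2 ^ k) ≡⟨ edge-end k ⟩
  a + b                    ≡⟨ +-comm a b ⟩
  b + a                    ≡⟨ edge-end k ⟨
  edge k b (b + a) (2 ^ k) ≡⟨ cong (edge k b (b + a)) (sum≡double-≤ (trans (+-comm m′ m) eq′) m′≤h m≤h) ⟨
  edge k b (b + a) m′      ≡⟨ edge-suc₁ k b a m′≤h ⟨
  edge (suc k) b a m′      ∎
  where eq′ = trans eq (2^suc k)
... | yes m≤h | no m′≰h = begin
  edge (suc k) a b m             ≡⟨ edge-suc₁ k a b m≤h ⟩
  edge k a (a + b) m             ≡⟨ edge-reverse k (sum≡double-∸ eq′ (<⇒≤ (≰⇒> m′≰h))) ⟩
  edge k (a + b) a (m′ ∸ 2 ^ k)  ≡⟨ cong (λ c → edge k c a (m′ ∸ 2 ^ k)) (+-comm a b) ⟩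
  edge k (b + a) a (m′ ∸ 2 ^ k)  ≡⟨ edge-suc₂ k b a m′≰h ⟨
  edge (suc k) b a m′            ∎
  where eq′ = trans eq (2^suc k)
... | no m≰h | yes m′≤h = sym (begin
  edge (suc k) b a m′            ≡⟨ edge-suc₁ k b a m′≤h ⟩
  edge k b (b + a) m′            ≡⟨ edge-reverse k (sum≡double-∸ eq′ (<⇒≤ (≰⇒> m≰h))) ⟩
  edge k (b + a) b (m ∸ 2 ^ k)   ≡⟨ cong (λ c → edge k c b (m ∸ 2 ^ k)) (+-comm b a) ⟩
  edge k (a + b) b (m ∸ 2 ^ k)   ≡⟨ edge-suc₂ k a b m≰h ⟨
  edge (suc k) a b m             ∎)
  where eq′ = trans (+-comm m′ m) (trans eq (2^suc k))
... | no m≰h | no m′≰h = ⊥-elim (sum≡double-≰ (trans eq (2^suc k)) m≰h m′≰h)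

val-xy-edge : ∀ k {i o x y z} → i ≤ 2 ^ k → val k (tile o x y z) (i , 0) ≡ edge k x y i
val-xy-edge zero {zero}        _ = refl
val-xy-edge zero {suc zero}    _ = refl
val-xy-edge zero {suc (suc _)} (s≤s ())
val-xy-edge (suc k) {i} {o} {x} {y} {z} i≤2h with i ≤? 2 ^ k
... | yes i≤h = begin
  val (suc k) (tile o x y z) (i , 0)        ≡⟨ val-suc₁ k o x y z refl (subst (_≤ 2 ^ k) (sym (+-identityʳ i)) i≤h) ⟩
  val k (tile o x (x + y) (x + z)) (i , 0)  ≡⟨ val-xy-edge k i≤h ⟩
  edge k x (x + y) i                        ≡⟨ edge-suc₁ k x y i≤h ⟨
  edge (suc k) x y i                        ∎
... | no i≰h = begin
  val (suc k) (tile o x y z) (i , 0)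
    ≡⟨ val-suc₂ k o x y z refl (i≰h ∘ subst (_≤ 2 ^ k) (+-identityʳ i)) (<⇒≤ (≰⇒> i≰h)) ⟩
  val k (tile o (x + y) y (y + z)) (i ∸ 2 ^ k , 0)  ≡⟨ val-xy-edge k (∸-half (subst (i ≤_) (2^suc k) i≤2h)) ⟩
  edge k (x + y) y (i ∸ 2 ^ k)                      ≡⟨ edge-suc₂ k x y i≰h ⟨
  edge (suc k) x y i                                ∎
  where
  ∸-half : ∀ {h} → i ≤ h + h → i ∸ h ≤ h
  ∸-half {h} i≤2h = ≤-trans (∸-monoˡ-≤ h i≤2h) (≤-reflexive (m+n∸m≡n h h))

val-x-vertex : ∀ k o x y z → val k (tile o x y z) (0 , 0) ≡ x
val-x-vertex k o x y z = trans (val-xy-edge k z≤n) (edge-start k)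

val-y-vertex : ∀ k o x y z → val k (tile o x y z) (2 ^ k , 0) ≡ y
val-y-vertex k o x y z = trans (val-xy-edge k ≤-refl) (edge-end k)

-- (i , j) ↦ (j , l), where i + j + l = 2^k, is the rotation by a third of a turn that takes
-- the x-, y- and z-vertex of σ^k(t) to its z-, x- and y-vertex.
RotationInvariant : ℕ → Set
RotationInvariant k = ∀ o x y z {i j l} → i + j + l ≡ 2 ^ k →
  val k (tile o x y z) (i , j) ≡ val k (tile o y z x) (j , l)

data Corner : ℕ → ℕ → ℕ → Set where
  x-vertex : Corner 0 0 1
  y-vertex : Corner 1 0 0
  z-vertex : Corner 0 1 0

corner : ∀ {i j l} → i + j + l ≡ 2 ^ 0 → Corner i j l
corner {zero}     {zero}     {suc zero}    _ = x-vertex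
corner {suc zero} {zero}     {zero}        _ = y-vertex
corner {zero}     {suc zero} {zero}        _ = z-vertex
corner {zero}     {zero}     {zero}        ()
corner {zero}     {zero}     {suc (suc _)} ()
corner {zero}     {suc zero} {suc _}       ()
corner {zero}     {suc (suc _)}            ()
corner {suc zero} {zero}     {suc _}       ()
corner {suc zero} {suc _}                  ()
corner {suc (suc _)}                       ()

-- The four tiles of σ(t), blown up to σ^k, cover σ^(k+1)(t).  Each constructor gives the
-- barycentric coordinates of a vertex inside its quarter (point-reflected in the centre).
data Quarter (k : ℕ) : ℕ → ℕ → ℕ → Set where
  x-quarter : ∀ {i j l} → i + j + l ≡ 2 ^ k → Quarter k i j (2 ^ k + l)
  y-quarter : ∀ {i j l} → i + j + l ≡ 2 ^ k → Quarter k (2 ^ k + i) j l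
  z-quarter : ∀ {i j l} → i + j + l ≡ 2 ^ k → Quarter k i (2 ^ k + j) l
  centre    : ∀ {a b c} → a + b + c ≡ 2 ^ k → Quarter k (b + c) (a + c) (a + b)

centre-coordinates : ∀ {h i j l a b c} → i + j + l ≡ h + h → i + a ≡ h → j + b ≡ h → l + c ≡ h →
  a + b + c ≡ h × i ≡ b + c × j ≡ a + c × l ≡ a + b
centre-coordinates {h} {i} {j} {l} {a} {b} {c} s i+a≡h j+b≡h l+c≡h = a+b+c≡h ,
  +-cancelʳ-≡ a i (b + c) (trans i+a≡h (trans (sym a+b+c≡h) (xy∙z≈yz∙x a b c))) ,
  +-cancelʳ-≡ b j (a + c) (trans j+b≡h (trans (sym a+b+c≡h) (xy∙z≈xz∙y a b c))) ,
  +-cancelʳ-≡ c l (a + b) (trans l+c≡h (sym a+b+c≡h))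
  where
  regroup : ∀ i j l a b c → (i + j + l) + (a + b + c) ≡ (i + a) + (j + b) + (l + c)
  regroup = solve-∀
  a+b+c≡h : a + b + c ≡ h
  a+b+c≡h = +-cancelˡ-≡ (h + h) (a + b + c) h (begin
    (h + h) + (a + b + c)        ≡⟨ cong (_+ (a + b + c)) s ⟨
    (i + j + l) + (a + b + c)    ≡⟨ regroup i j l a b c ⟩
    (i + a) + (j + b) + (l + c)  ≡⟨ cong₂ _+_ (cong₂ _+_ i+a≡h j+b≡h) l+c≡h ⟩
    h + h + h                    ∎)

quarter : ∀ k {i j l} → i + j + l ≡ 2 ^ suc k → Quarter k i j l
quarter k {i} {j} {l} s with 2 ^ k ≤? l | 2 ^ k ≤? i | 2 ^ k ≤? j
... | yes h≤l | _ | _ with m≤n⇒∃[o]m+o≡n h≤l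
...   | l′ , refl = x-quarter (drop-h (trans (regroup (2 ^ k) i j l′) s))
  where
  regroup : ∀ h i j l → h + (i + j + l) ≡ i + j + (h + l)
  regroup = solve-∀
  drop-h : ∀ {m} → 2 ^ k + m ≡ 2 ^ suc k → m ≡ 2 ^ k
  drop-h eq = +-cancelˡ-≡ (2 ^ k) _ _ (trans eq (2^suc k))
quarter k {i} {j} {l} s | no _ | yes h≤i | _ with m≤n⇒∃[o]m+o≡n h≤i
...   | i′ , refl = y-quarter (drop-h (trans (regroup (2 ^ k) i′ j l) s))
  where
  regroup : ∀ h i j l → h + (i + j + l) ≡ h + i + j + l
  regroup = solve-∀
  drop-h : ∀ {m} → 2 ^ k + m ≡ 2 ^ suc k → m ≡ 2 ^ k
  drop-h eq = +-cancelˡ-≡ (2 ^ k) _ _ (trans eq (2^suc k))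
quarter k {i} {j} {l} s | no _ | no _ | yes h≤j with m≤n⇒∃[o]m+o≡n h≤j
...   | j′ , refl = z-quarter (drop-h (trans (regroup (2 ^ k) i j′ l) s))
  where
  regroup : ∀ h i j l → h + (i + j + l) ≡ i + (h + j) + l
  regroup = solve-∀
  drop-h : ∀ {m} → 2 ^ k + m ≡ 2 ^ suc k → m ≡ 2 ^ k
  drop-h eq = +-cancelˡ-≡ (2 ^ k) _ _ (trans eq (2^suc k))
quarter k {i} {j} {l} s | no h≰l | no h≰i | no h≰j
  with m≤n⇒∃[o]m+o≡n (<⇒≤ (≰⇒> h≰i))
     | m≤n⇒∃[o]m+o≡n (<⇒≤ (≰⇒> h≰j))
     | m≤n⇒∃[o]m+o≡n (<⇒≤ (≰⇒> h≰l))
... | a , i+a≡h | b , j+b≡h | c , l+c≡h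
  with centre-coordinates {2 ^ k} {i} {j} {l} {a} {b} {c} (trans s (2^suc k)) i+a≡h j+b≡h l+c≡h
... | a+b+c≡h , refl , refl , refl = centre {a = a} {b = b} {c = c} a+b+c≡h

val-x-quarter : ∀ k o x y z {i j l} → i + j + l ≡ 2 ^ k →
  val (suc k) (tile o x y z) (i , j) ≡ val k (tile o x (x + y) (x + z)) (i , j)
val-x-quarter k o x y z {i} {j} {l} s = val-suc₁ k o x y z refl (≤-trans (m≤m+n (i + j) l) (≤-reflexive s))

val-y-quarter-interior : ∀ k o x y z {i j} → 0 < i + j →
  val (suc k) (tile o x y z) (2 ^ k + i , j) ≡ val k (tile o (x + y) y (y + z)) (i , j)
val-y-quarter-interior k o x y z {i} {j} 0<i+j = begin
  val (suc k) (tile o x y z) (2 ^ k + i , j)                ≡⟨ val-suc₂ k o x y z refl overfull (m≤m+n (2 ^ k) i) ⟩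
  val k (tile o (x + y) y (y + z)) (2 ^ k + i ∸ 2 ^ k , j)  ≡⟨ vertex-cong k (tile o (x + y) y (y + z)) (m+n∸m≡n (2 ^ k) i) refl ⟩
  val k (tile o (x + y) y (y + z)) (i , j)                  ∎
  where
  overfull : 2 ^ k + i + j ≰ 2 ^ k
  overfull = <⇒≱ (subst (2 ^ k <_) (sym (+-assoc (2 ^ k) i j)) (m<m+n (2 ^ k) 0<i+j))

val-y-quarter : ∀ k o x y z {i j l} → i + j + l ≡ 2 ^ k →
  val (suc k) (tile o x y z) (2 ^ k + i , j) ≡ val k (tile o (x + y) y (y + z)) (i , j)
val-y-quarter k o x y z {zero} {zero} _ = begin
  val (suc k) (tile o x y z) (2 ^ k + 0 , 0)        ≡⟨ val-suc₁ k o x y z refl (≤-reflexive (trans (+-identityʳ _) (+-identityʳ _))) ⟩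
  val k (tile o x (x + y) (x + z)) (2 ^ k + 0 , 0)  ≡⟨ vertex-cong k (tile o x (x + y) (x + z)) (+-identityʳ (2 ^ k)) refl ⟩
  val k (tile o x (x + y) (x + z)) (2 ^ k , 0)      ≡⟨ val-y-vertex k o x (x + y) (x + z) ⟩
  x + y                                             ≡⟨ val-x-vertex k o (x + y) y (y + z) ⟨
  val k (tile o (x + y) y (y + z)) (0 , 0)          ∎
val-y-quarter k o x y z {suc i}        _ = val-y-quarter-interior k o x y z (s≤s z≤n)
val-y-quarter k o x y z {zero} {suc j} _ = val-y-quarter-interior k o x y z (s≤s z≤n)

module _ (k : ℕ) (rot : RotationInvariant k) where

  val-yz-edge : ∀ o x y z {i j} → i + j ≡ 2 ^ k → val k (tile o x y z) (i , j) ≡ edge k y z j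
  val-yz-edge o x y z {i} {j} i+j≡h = begin
    val k (tile o x y z) (i , j)  ≡⟨ rot o x y z (trans (+-identityʳ (i + j)) i+j≡h) ⟩
    val k (tile o y z x) (j , 0)  ≡⟨ val-xy-edge k (subst (j ≤_) i+j≡h (m≤n+m j i)) ⟩
    edge k y z j                  ∎

  val-xz-edge : ∀ o x y z {j} → j ≤ 2 ^ k → val k (tile o x y z) (0 , j) ≡ edge k x z j
  val-xz-edge o x y z {j} j≤h = begin
    val k (tile o x y z) (0 , j)  ≡⟨ rot o z x y l+0+j≡h ⟨
    val k (tile o z x y) (l , 0)  ≡⟨ val-xy-edge k (m∸n≤m (2 ^ k) j) ⟩
    edge k z x l                  ≡⟨ edge-reverse k (m∸n+n≡m j≤h) ⟩
    edge k x z j                  ∎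
    where
    l : ℕ
    l = 2 ^ k ∸ j
    l+0+j≡h : l + 0 + j ≡ 2 ^ k
    l+0+j≡h = trans (cong (_+ j) (+-identityʳ l)) (m∸n+n≡m j≤h)

  val-z-vertex : ∀ o x y z → val k (tile o x y z) (0 , 2 ^ k) ≡ z
  val-z-vertex o x y z = trans (val-xz-edge o x y z ≤-refl) (edge-end k)

  val-z-quarter-interior : ∀ o x y z {i j} → 0 < i + j → 2 ^ k ≰ i →
    val (suc k) (tile o x y z) (i , 2 ^ k + j) ≡ val k (tile o (x + z) (y + z) z) (i , j)
  val-z-quarter-interior o x y z {i} {j} 0<i+j h≰i = begin
    val (suc k) (tile o x y z) (i , 2 ^ k + j)                ≡⟨ val-suc₃ k o x y z refl overfull h≰i (m≤m+n (2 ^ k) j) ⟩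
    val k (tile o (x + z) (y + z) z) (i , 2 ^ k + j ∸ 2 ^ k)  ≡⟨ vertex-cong k (tile o (x + z) (y + z) z) refl (m+n∸m≡n (2 ^ k) j) ⟩
    val k (tile o (x + z) (y + z) z) (i , j)                  ∎
    where
    overfull : i + (2 ^ k + j) ≰ 2 ^ k
    overfull = <⇒≱ (subst (2 ^ k <_) (sym (x∙yz≈y∙xz i (2 ^ k) j)) (m<m+n (2 ^ k) 0<i+j))

  val-z-quarter-far-vertex : ∀ o x y z →
    val (suc k) (tile o x y z) (2 ^ k , 2 ^ k + 0) ≡ val k (tile o (x + z) (y + z) z) (2 ^ k , 0)
  val-z-quarter-far-vertex o x y z = begin
    val (suc k) (tile o x y z) (2 ^ k , 2 ^ k + 0)                ≡⟨ val-suc₂ k o x y z refl overfull ≤-refl ⟩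
    val k (tile o (x + y) y (y + z)) (2 ^ k ∸ 2 ^ k , 2 ^ k + 0)
      ≡⟨ vertex-cong k (tile o (x + y) y (y + z)) (n∸n≡0 (2 ^ k)) (+-identityʳ (2 ^ k)) ⟩
    val k (tile o (x + y) y (y + z)) (0 , 2 ^ k)                  ≡⟨ val-z-vertex o (x + y) y (y + z) ⟩
    y + z                                                         ≡⟨ val-y-vertex k o (x + z) (y + z) z ⟨
    val k (tile o (x + z) (y + z) z) (2 ^ k , 0)                  ∎
    where
    overfull : 2 ^ k + (2 ^ k + 0) ≰ 2 ^ k
    overfull = <⇒≱ (m<m+n (2 ^ k) (subst (0 <_) (sym (+-identityʳ _)) (m^n>0 2 k)))

  val-z-quarter : ∀ o x y z {i j l} → i + j + l ≡ 2 ^ k →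
    val (suc k) (tile o x y z) (i , 2 ^ k + j) ≡ val k (tile o (x + z) (y + z) z) (i , j)
  val-z-quarter o x y z {zero} {zero} _ = begin
    val (suc k) (tile o x y z) (0 , 2 ^ k + 0)        ≡⟨ val-suc₁ k o x y z refl (≤-reflexive (+-identityʳ _)) ⟩
    val k (tile o x (x + y) (x + z)) (0 , 2 ^ k + 0)  ≡⟨ vertex-cong k (tile o x (x + y) (x + z)) refl (+-identityʳ (2 ^ k)) ⟩
    val k (tile o x (x + y) (x + z)) (0 , 2 ^ k)      ≡⟨ val-z-vertex o x (x + y) (x + z) ⟩
    x + z                                             ≡⟨ val-x-vertex k o (x + z) (y + z) z ⟨
    val k (tile o (x + z) (y + z) z) (0 , 0)          ∎
  val-z-quarter o x y z {zero} {suc j} _ = val-z-quarter-interior o x y z (s≤s z≤n) (<⇒≱ (m^n>0 2 k))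
  val-z-quarter o x y z {suc i} {j} s with 2 ^ k ≤? suc i
  ... | no h≰i = val-z-quarter-interior o x y z (s≤s z≤n) h≰i
  ... | yes h≤i with summand≥sum (proj₁ (summand≥sum s (≤-trans h≤i (m≤m+n (suc i) j)))) h≤i
  ...   | i+1≡h , refl =
    subst (λ m → val (suc k) (tile o x y z) (m , 2 ^ k + 0) ≡ val k (tile o (x + z) (y + z) z) (m , 0))
          (sym i+1≡h) (val-z-quarter-far-vertex o x y z)

  val-centre : ∀ o x y z {a b c} → a + b + c ≡ 2 ^ k →
    val (suc k) (tile o x y z) (b + c , a + c) ≡ val k (tile (flip o) (y + z) (x + z) (x + y)) (a , b)
  val-centre o x y z {a} {b} {zero} s = begin
    val (suc k) (tile o x y z) (b + 0 , a + 0)             ≡⟨ vertex-cong (suc k) (tile o x y z) (+-identityʳ b) (+-identityʳ a) ⟩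
    val (suc k) (tile o x y z) (b , a)                     ≡⟨ val-suc₁ k o x y z refl (≤-reflexive b+a≡h) ⟩
    val k (tile o x (x + y) (x + z)) (b , a)               ≡⟨ val-yz-edge o x (x + y) (x + z) b+a≡h ⟩
    edge k (x + y) (x + z) a                               ≡⟨ edge-reverse k a+b≡h ⟩
    edge k (x + z) (x + y) b                               ≡⟨ val-yz-edge (flip o) (y + z) (x + z) (x + y) a+b≡h ⟨
    val k (tile (flip o) (y + z) (x + z) (x + y)) (a , b)  ∎
    where
    a+b≡h : a + b ≡ 2 ^ k
    a+b≡h = trans (sym (+-identityʳ (a + b))) s
    b+a≡h : b + a ≡ 2 ^ k
    b+a≡h = trans (+-comm b a) a+b≡h
  val-centre o x y z {zero} {b} {c@(suc _)} s = begin
    val (suc k) (tile o x y z) (b + c , c)                 ≡⟨ val-suc₂ k o x y z (sym s) (m+1+n≰m (b + c)) ≤-refl ⟩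
    val k (tile o (x + y) y (y + z)) (b + c ∸ (b + c) , c) ≡⟨ vertex-cong k (tile o (x + y) y (y + z)) (n∸n≡0 (b + c)) refl ⟩
    val k (tile o (x + y) y (y + z)) (0 , c)               ≡⟨ val-xz-edge o (x + y) y (y + z) (subst (c ≤_) s (m≤n+m c b)) ⟩
    edge k (x + y) (y + z) c                               ≡⟨ edge-reverse k (trans (+-comm c b) s) ⟩
    edge k (y + z) (x + y) b                               ≡⟨ val-xz-edge (flip o) (y + z) (x + z) (x + y) (subst (b ≤_) s (m≤m+n b c)) ⟨
    val k (tile (flip o) (y + z) (x + z) (x + y)) (0 , b)  ∎
  val-centre o x y z {a@(suc a′)} {zero} {c@(suc c′)} s = begin
    val (suc k) (tile o x y z) (c , a + c)
      ≡⟨ val-suc₃ k o x y z h≡a+c (≡+suc⇒≰ c′ (+-comm c (a + c))) (≡+suc⇒≰ a′ (+-comm a c)) ≤-refl ⟩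
    val k (tile o (x + z) (y + z) z) (c , a + c ∸ (a + c)) ≡⟨ vertex-cong k (tile o (x + z) (y + z) z) refl (n∸n≡0 (a + c)) ⟩
    val k (tile o (x + z) (y + z) z) (c , 0)               ≡⟨ val-xy-edge k (subst (c ≤_) (sym h≡a+c) (m≤n+m c a)) ⟩
    edge k (x + z) (y + z) c                               ≡⟨ edge-reverse k (trans (+-comm c a) (sym h≡a+c)) ⟩
    edge k (y + z) (x + z) a                               ≡⟨ val-xy-edge k (subst (a ≤_) (sym h≡a+c) (m≤m+n a c)) ⟨
    val k (tile (flip o) (y + z) (x + z) (x + y)) (a , 0)  ∎
    where
    h≡a+c : 2 ^ k ≡ a + c
    h≡a+c = trans (sym s) (cong (_+ c) (+-identityʳ a))
  val-centre o x y z {a@(suc a′)} {b@(suc b′)} {c@(suc c′)} s = begin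
    val (suc k) (tile o x y z) (b + c , a + c)
      ≡⟨ val-suc₄ k o x y z {i = b + c} {j = a + c} (sym s)
           (≡+suc⇒≰ c′ (regroup a b c)) (≡+suc⇒≰ a′ (xy∙z≈yz∙x a b c)) (≡+suc⇒≰ b′ (xy∙z≈xz∙y a b c)) ⟩
    val k (tile (flip o) (y + z) (x + z) (x + y)) (a + b + c ∸ (b + c) , a + b + c ∸ (a + c))
      ≡⟨ vertex-cong k (tile (flip o) (y + z) (x + z) (x + y))
               (trans (cong (_∸ (b + c)) (+-assoc a b c)) (m+n∸n≡m a (b + c)))
               (trans (cong (_∸ (a + c)) (xy∙z≈y∙xz a b c)) (m+n∸n≡m b (a + c))) ⟩
    val k (tile (flip o) (y + z) (x + z) (x + y)) (a , b)
      ∎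
    where
    regroup : ∀ a b c → b + c + (a + c) ≡ a + b + c + c
    regroup = solve-∀

rotation-invariant : ∀ k → RotationInvariant k
rotation-invariant zero o x y z {i} {j} {l} s with corner {i} {j} {l} s
... | x-vertex = refl
... | y-vertex = refl
... | z-vertex = refl
rotation-invariant (suc k) o x y z {i} {j} {l} s with quarter k {i} {j} {l} s
... | x-quarter {i} {j} {l} s′ = begin
  val (suc k) (tile o x y z) (i , j)          ≡⟨ val-x-quarter k o x y z s′ ⟩
  val k (tile o x (x + y) (x + z)) (i , j)    ≡⟨ rot o x (x + y) (x + z) s′ ⟩
  val k (tile o (x + y) (x + z) x) (j , l)    ≡⟨ cong (λ t → val k t (j , l)) (corners-cong (+-comm x y) (+-comm x z) refl) ⟩
  val k (tile o (y + x) (z + x) x) (j , l)    ≡⟨ val-z-quarter k rot o y z x (rotate-sum i j l s′) ⟨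
  val (suc k) (tile o y z x) (j , 2 ^ k + l)  ∎
  where rot = rotation-invariant k
... | y-quarter {i} {j} {l} s′ = begin
  val (suc k) (tile o x y z) (2 ^ k + i , j)  ≡⟨ val-y-quarter k o x y z s′ ⟩
  val k (tile o (x + y) y (y + z)) (i , j)    ≡⟨ rot o (x + y) y (y + z) s′ ⟩
  val k (tile o y (y + z) (x + y)) (j , l)    ≡⟨ cong (λ t → val k t (j , l)) (corners-cong refl refl (+-comm x y)) ⟩
  val k (tile o y (y + z) (y + x)) (j , l)    ≡⟨ val-x-quarter k o y z x (rotate-sum i j l s′) ⟨
  val (suc k) (tile o y z x) (j , l)          ∎
  where rot = rotation-invariant k
... | z-quarter {i} {j} {l} s′ = begin
  val (suc k) (tile o x y z) (i , 2 ^ k + j)  ≡⟨ val-z-quarter k rot o x y z s′ ⟩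
  val k (tile o (x + z) (y + z) z) (i , j)    ≡⟨ rot o (x + z) (y + z) z s′ ⟩
  val k (tile o (y + z) z (x + z)) (j , l)    ≡⟨ cong (λ t → val k t (j , l)) (corners-cong refl refl (+-comm x z)) ⟩
  val k (tile o (y + z) z (z + x)) (j , l)    ≡⟨ val-y-quarter k o y z x (rotate-sum i j l s′) ⟨
  val (suc k) (tile o y z x) (2 ^ k + j , l)  ∎
  where rot = rotation-invariant k
... | centre {a} {b} {c} s′ = begin
  val (suc k) (tile o x y z) (b + c , a + c)             ≡⟨ val-centre k rot o x y z s′ ⟩
  val k (tile (flip o) (y + z) (x + z) (x + y)) (a , b)  ≡⟨ rot (flip o) (y + z) (x + z) (x + y) s′ ⟩
  val k (tile (flip o) (x + z) (x + y) (y + z)) (b , c)  ≡⟨ cong (λ t → val k t (b , c)) (corners-cong (+-comm x z) (+-comm x y) refl) ⟩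
  val k (tile (flip o) (z + x) (y + x) (y + z)) (b , c)  ≡⟨ val-centre k rot o y z x (rotate-sum a b c s′) ⟨
  val (suc k) (tile o y z x) (c + a , b + a)             ≡⟨ vertex-cong (suc k) (tile o y z x) (+-comm c a) (+-comm b a) ⟩
  val (suc k) (tile o y z x) (a + c , a + b)             ∎
  where rot = rotation-invariant k

-- The orbit of the vertex (i , j) under the rotations by a third of a turn about the centre
-- of the triangle of side n.
data Orbit (n : ℕ) : Vertex → Vertex → Vertex → Set where
  orbit : ∀ {i j l} → i + j + l ≡ n → Orbit n (i , j) (j , l) (l , i)

rotate-orbit : ∀ {n v₁ v₂ v₃} → Orbit n v₁ v₂ v₃ → Orbit n v₂ v₃ v₁
rotate-orbit (orbit {i} {j} {l} s) = orbit (rotate-sum i j l s)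

complete-orbit : ∀ {n i j l i₃ j₃} → i + j + l ≡ n → i + j + i₃ ≡ n → j + l + j₃ ≡ n →
  Orbit n (i , j) (j , l) (i₃ , j₃)
complete-orbit {i = i} {j} {l} s Σi≡n Σj≡n
  with +-cancel-last i j Σi≡n s | +-cancel-last j l Σj≡n (rotate-sum i j l s)
... | refl | refl = orbit s

equilateral⇒orbit : ∀ {n v₁ v₂ v₃} → SameCenter n v₁ v₂ v₃ →
  sqDist v₁ v₂ ≡ sqDist v₂ v₃ → sqDist v₂ v₃ ≡ sqDist v₃ v₁ → Orbit n v₁ v₂ v₃ ⊎ Orbit n v₁ v₃ v₂
equilateral⇒orbit {n} {i₁ , j₁} {i₂ , j₂} {i₃ , j₃} centred@(Σi≡n , Σj≡n) d₁₂≡d₂₃ d₂₃≡d₃₁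
  with equilateral⇒rotation {n} {i₁} {j₁} {i₂} {j₂} {i₃} {j₃} centred d₁₂≡d₂₃ d₂₃≡d₃₁
... | inj₁ (s , refl) = inj₂ (rotate-orbit (complete-orbit (trans (xy∙z≈yz∙x i₂ i₁ j₁) s)
        (trans (cong (_+ i₃) (+-comm i₂ i₁)) Σi≡n) (trans (cong (_+ j₃) (+-comm i₁ j₁)) Σj≡n)))
... | inj₂ (refl , s) = inj₁ (complete-orbit s Σi≡n Σj≡n)

DividesAll : ℕ → ℕ → Tile → Vertex → Vertex → Vertex → Set
DividesAll p k t v₁ v₂ v₃ = p ∣ val k t v₁ × p ∣ val k t v₂ × p ∣ val k t v₃

module _ {p} (p-prime : Prime p) (p∤2 : ¬ p ∣ 2) where

  p∤1 : ¬ p ∣ 1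
  p∤1 p∣1 = nonTrivial⇒≢1 {{prime⇒nonTrivial p-prime}} (∣1⇒≡1 p∣1)

  ∣m+n∣n⇒∣m : ∀ {m n} → p ∣ m + n → p ∣ n → p ∣ m
  ∣m+n∣n⇒∣m {m} {n} p∣m+n = ∣m+n∣m⇒∣n (subst (p ∣_) (+-comm m n) p∣m+n)

  ∣2*n⇒∣n : ∀ {n} → p ∣ 2 * n → p ∣ n
  ∣2*n⇒∣n {n} p∣2n with euclidsLemma 2 n p-prime p∣2n
  ... | inj₁ p∣2 = contradiction p∣2 p∤2
  ... | inj₂ p∣n = p∣n

  ∣pairwise-sums⇒∣ : ∀ {a b c} → p ∣ b + c → p ∣ a + c → p ∣ a + b → p ∣ a × p ∣ b × p ∣ c
  ∣pairwise-sums⇒∣ {a} {b} {c} p∣b+c p∣a+c p∣a+b = p∣a , ∣m+n∣m⇒∣n p∣a+b p∣a , ∣m+n∣m⇒∣n p∣a+c p∣a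
    where
    doubled : ∀ a b c → b + c + (a + c + (a + b)) ≡ 2 * (a + (b + c))
    doubled = solve-∀
    p∣a+[b+c] : p ∣ a + (b + c)
    p∣a+[b+c] = ∣2*n⇒∣n (subst (p ∣_) (doubled a b c) (∣m∣n⇒∣m+n p∣b+c (∣m∣n⇒∣m+n p∣a+c p∣a+b)))
    p∣a : p ∣ a
    p∣a = ∣m+n∣n⇒∣m p∣a+[b+c] p∣b+c

  unit-values-indivisible : ∀ k o {i j l} → i + j + l ≡ 2 ^ k →
    ¬ (p ∣ val k (tile o 1 0 0) (i , j) × p ∣ val k (tile o 0 1 0) (i , j) × p ∣ val k (tile o 0 0 1) (i , j))
  unit-values-indivisible zero o {i} {j} {l} s with corner {i} {j} {l} s
  ... | x-vertex = λ (p∣1 , _ , _) → p∤1 p∣1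
  ... | y-vertex = λ (_ , p∣1 , _) → p∤1 p∣1
  ... | z-vertex = λ (_ , _ , p∣1) → p∤1 p∣1
  unit-values-indivisible (suc k) o {i} {j} {l} s (p∣A , p∣B , p∣C) with quarter k {i} {j} {l} s
  ... | x-quarter {i} {j} s′ =
    unit-values-indivisible k o s′ (∣m+n∣n⇒∣m p∣A+[B+C] (∣m∣n⇒∣m+n p∣B′ p∣C′) , p∣B′ , p∣C′)
    where
    p∣A+[B+C] = subst (p ∣_) (trans (val-x-quarter k o 1 0 0 s′) (val-111 k o (i , j))) p∣A
    p∣B′ = subst (p ∣_) (val-x-quarter k o 0 1 0 s′) p∣B
    p∣C′ = subst (p ∣_) (val-x-quarter k o 0 0 1 s′) p∣C
  ... | y-quarter {i} {j} s′ =
    unit-values-indivisible k o s′ (p∣A′ , ∣m+n∣n⇒∣m (∣m+n∣m⇒∣n p∣A+[B+C] p∣A′) p∣C′ , p∣C′)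
    where
    p∣A′ = subst (p ∣_) (val-y-quarter k o 1 0 0 s′) p∣A
    p∣A+[B+C] = subst (p ∣_) (trans (val-y-quarter k o 0 1 0 s′) (val-111 k o (i , j))) p∣B
    p∣C′ = subst (p ∣_) (val-y-quarter k o 0 0 1 s′) p∣C
  ... | z-quarter {i} {j} s′ =
    unit-values-indivisible k o s′ (p∣A′ , p∣B′ , ∣m+n∣m⇒∣n (∣m+n∣m⇒∣n p∣A+[B+C] p∣A′) p∣B′)
    where
    rot = rotation-invariant k
    p∣A′ = subst (p ∣_) (val-z-quarter k rot o 1 0 0 s′) p∣A
    p∣B′ = subst (p ∣_) (val-z-quarter k rot o 0 1 0 s′) p∣B
    p∣A+[B+C] = subst (p ∣_) (trans (val-z-quarter k rot o 0 0 1 s′) (val-111 k o (i , j))) p∣C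
  ... | centre {a} {b} s′ =
    unit-values-indivisible k (flip o) s′ (∣pairwise-sums⇒∣ p∣B+C p∣A+C p∣A+B)
    where
    rot = rotation-invariant k
    p∣B+C = subst (p ∣_) (trans (val-centre k rot o 1 0 0 s′) (val-additive k (flip o) 0 1 0 0 0 1 (a , b))) p∣A
    p∣A+C = subst (p ∣_) (trans (val-centre k rot o 0 1 0 s′) (val-additive k (flip o) 1 0 0 0 0 1 (a , b))) p∣B
    p∣A+B = subst (p ∣_) (trans (val-centre k rot o 0 0 1 s′) (val-additive k (flip o) 1 0 0 0 1 0 (a , b))) p∣C

  x-tile-orbit-indivisible : ∀ k o {v₁ v₂ v₃} → Orbit (2 ^ k) v₁ v₂ v₃ → ¬ DividesAll p k (tile o 1 0 0) v₁ v₂ v₃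
  x-tile-orbit-indivisible k o (orbit {i} {j} {l} s) (p∣A , p∣B , p∣C) = unit-values-indivisible k o s
    (p∣A , subst (p ∣_) (sym (rot o 0 1 0 s)) p∣B , subst (p ∣_) (rot o 1 0 0 (rotate-sum j l i (rotate-sum i j l s))) p∣C)
    where rot = rotation-invariant k

  rotate-labels : ∀ k o x y z {v₁ v₂ v₃} → Orbit (2 ^ k) v₁ v₂ v₃ →
    DividesAll p k (tile o x y z) v₁ v₂ v₃ → DividesAll p k (tile o y z x) v₂ v₃ v₁
  rotate-labels k o x y z (orbit {i} {j} {l} s) (p∣A , p∣B , p∣C) =
    subst (p ∣_) (rot o x y z s) p∣A ,
    subst (p ∣_) (rot o x y z (rotate-sum i j l s)) p∣B ,
    subst (p ∣_) (rot o x y z (rotate-sum j l i (rotate-sum i j l s))) p∣C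
    where rot = rotation-invariant k

  y-tile-orbit-indivisible : ∀ k o {v₁ v₂ v₃} → Orbit (2 ^ k) v₁ v₂ v₃ → ¬ DividesAll p k (tile o 0 1 0) v₁ v₂ v₃
  y-tile-orbit-indivisible k o v₁v₂v₃ = x-tile-orbit-indivisible k o (rotate-orbit v₁v₂v₃) ∘ rotate-labels k o 0 1 0 v₁v₂v₃

  z-tile-orbit-indivisible : ∀ k o {v₁ v₂ v₃} → Orbit (2 ^ k) v₁ v₂ v₃ → ¬ DividesAll p k (tile o 0 0 1) v₁ v₂ v₃
  z-tile-orbit-indivisible k o v₁v₂v₃ = y-tile-orbit-indivisible k o (rotate-orbit v₁v₂v₃) ∘ rotate-labels k o 0 0 1 v₁v₂v₃

  orbit-indivisible : ∀ k {t v₁ v₂ v₃} → t ∈ initialTiles → Orbit (2 ^ k) v₁ v₂ v₃ → ¬ DividesAll p k t v₁ v₂ v₃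
  orbit-indivisible k (here refl)                                         = x-tile-orbit-indivisible k up
  orbit-indivisible k (there (here refl))                                 = y-tile-orbit-indivisible k up
  orbit-indivisible k (there (there (here refl)))                         = z-tile-orbit-indivisible k up
  orbit-indivisible k (there (there (there (here refl))))                 = x-tile-orbit-indivisible k down
  orbit-indivisible k (there (there (there (there (here refl)))))         = y-tile-orbit-indivisible k down
  orbit-indivisible k (there (there (there (there (there (here refl)))))) = z-tile-orbit-indivisible k down

odd-prime∤2 : ∀ {p} → Prime p → p % 2 ≡ 1 → ¬ p ∣ 2
odd-prime∤2 {0}                 _       ()
odd-prime∤2 {1}                 p-prime _  _   = nonTrivial⇒≢1 {{prime⇒nonTrivial p-prime}} refl
odd-prime∤2 {2}                 _       ()
odd-prime∤2 {suc (suc (suc _))} _       _  p∣2 = contradiction (∣⇒≤ p∣2) λ { (s≤s (s≤s ())) }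

mainTheorem11 : (p : ℕ) → Prime p → p % 2 ≡ 1 →
    (k : ℕ) → (t : Tile) → t ∈ initialTiles →
    (v₁ v₂ v₃ : Vertex) →
    InTri (2 ^ k) v₁ → InTri (2 ^ k) v₂ → InTri (2 ^ k) v₃ →
    Equilateral v₁ v₂ v₃ → SameCenter (2 ^ k) v₁ v₂ v₃ →
    ¬ (p ∣ val k t v₁ × p ∣ val k t v₂ × p ∣ val k t v₃)
mainTheorem11 p p-prime p-odd k t t∈initial v₁ v₂ v₃ _ _ _ (_ , d₁₂≡d₂₃ , d₂₃≡d₃₁) centred
  with equilateral⇒orbit centred d₁₂≡d₂₃ d₂₃≡d₃₁
... | inj₁ v₁v₂v₃ = orbit-indivisible p-prime p∤2 k t∈initial v₁v₂v₃
  where p∤2 = odd-prime∤2 p-prime p-odd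
... | inj₂ v₁v₃v₂ = λ (p∣v₁ , p∣v₂ , p∣v₃) →
  orbit-indivisible p-prime p∤2 k t∈initial v₁v₃v₂ (p∣v₁ , p∣v₃ , p∣v₂)
  where p∤2 = odd-prime∤2 p-prime p-odd
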